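{- For every connected graph $G$, $\zeta(G)\le(\mathrm{tw}(G)+1)(\Delta(G)+1)$, and $\mathrm{capt}_{\zeta,(\mathrm{tw}(G)+1)(\Delta(G)+1)}(G)\le\mathrm{tr}(G)+1$.
   Context: $\Delta(G)$ is the maximum degree. A tree decomposition of $G$ is a pair consisting of a tree $T$ and subsets $B_t\subseteq V(G)$ (bags) for $t\in V(T)$ such that every vertex of $G$ lies in some bag, every edge of $G$ has both ends in some bag, and whenever $t$ lies on the path in $T$ between $s$ and $u$, $B_s\cap B_u\subseteq B_t$. Its width is the maximum bag size minus one; the treewidth $\mathrm{tw}(G)$ is the minimum width of a tree decomposition. The tree radius $\mathrm{tr}(G)$ is the minimum radius of the tree $T$ over all tree decompositions of $G$ of width $\mathrm{tw}(G)$. The localization game on $G$ with $k$ cops: the robber, invisible to the cops, first chooses a starting vertex. In each round the cops choose a multiset of vertices $u_1,\dots,u_k$ (no adjacency restriction) and learn the distances $d(u_i,R)$ to the robber's current vertex $R$; the cops capture the robber if, from all information so far, they can determine the robber's vertex uniquely. If not captured, the robber moves to a neighbor or stays. The robber is omniscient. The localization number $\zeta(G)$ is the least number of cops guaranteeing capture in finitely many rounds. For $k\ge\zeta(G)$, $\mathrm{capt}_{\zeta,k}(G)$ is the minimum number of rounds in which $k$ cops can guarantee capture under optimal play. -}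

module Defs where

open import Data.Nat using (ℕ; zero; suc; _+_; _*_; _≤_; _<_)
open import Data.Bool using (Bool; true; false; _∧_; _∨_; if_then_else_)
open import Data.Fin using (Fin; _≟_)
open import Data.Fin.Subset using (Subset; ∣_∣) renaming (_∈_ to _∈ₛ_)
open import Data.List using (List; []; _∷_; _++_; [_]; length; last)
open import Data.Bool.ListAction using (any)
open import Data.List.Membership.Propositional using () renaming (_∈_ to _∈ₗ_)
open import Data.List.Relation.Unary.Linked using (Linked)
open import Data.List.Relation.Unary.Unique.Propositional using (Unique)
open import Data.Maybe using (just)
open import Data.Vec using (Vec; tabulate)
import Data.Vec as V
open import Data.Fin.Base using ()
open import Data.List.Base using ()
open import Data.Product using (Σ; ∃; _×_; _,_)
open import Data.Sum using (_⊎_)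
open import Data.Empty using (⊥)
open import Relation.Nullary using (¬_)
open import Relation.Nullary.Decidable using (⌊_⌋)
open import Relation.Binary.PropositionalEquality using (_≡_)
import Data.List as L

record Graph : Set where
  field
    size   : ℕ
    adj    : Fin size → Fin size → Bool
    sym    : ∀ u v → adj u v ≡ adj v u
    irrefl : ∀ v → adj v v ≡ false
open Graph public

Vtx : Graph → Set
Vtx G = Fin (size G)

Adj : (G : Graph) → Vtx G → Vtx G → Set
Adj G u v = adj G u v ≡ true

data Walk (G : Graph) : Vtx G → Vtx G → Set where
  here : ∀ {v} → Walk G v v
  step : ∀ {u w v} → Adj G u w → Walk G w v → Walk G u v

Connected : Graph → Set
Connected G = Vtx G × (∀ u v → Walk G u v)

degree : (G : Graph) → Vtx G → ℕ
degree G v = ∣ tabulate (adj G v) ∣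

IsMaxDegree : Graph → ℕ → Set
IsMaxDegree G d = (∀ v → degree G v ≤ d) × (∃ λ v → degree G v ≡ d)

reachWithin : (G : Graph) → ℕ → Vtx G → Vtx G → Bool
reachWithin G zero    u v = ⌊ u ≟ v ⌋
reachWithin G (suc k) u v =
  reachWithin G k u v ∨ any (λ w → reachWithin G k u w ∧ adj G w v) (L.allFin (size G))

-- least b f : least k < b with f k = true, or b if there is none
least : ℕ → (ℕ → Bool) → ℕ
least zero    f = zero
least (suc b) f = if f zero then zero else suc (least b (λ k → f (suc k)))

-- graph distance d(u,v) (for connected graphs this is the length of a shortest walk)
dist : (G : Graph) → Vtx G → Vtx G → ℕ
dist G u v = least (size G) (λ k → reachWithin G k u v)

-- s ∷ xs is a path from s to u (distinct vertices, consecutive ones adjacent)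
PathBetween : (G : Graph) → Vtx G → Vtx G → List (Vtx G) → Set
PathBetween G s u xs =
  Linked (Adj G) (s ∷ xs) × Unique (s ∷ xs) × last (s ∷ xs) ≡ just u

-- v ∷ xs is a cycle: at least 3 distinct vertices, consecutive adjacent, last adjacent to v
IsCycle : (G : Graph) → Vtx G → List (Vtx G) → Set
IsCycle G v xs = 2 ≤ length xs × Linked (Adj G) (v ∷ xs) × Unique (v ∷ xs)
  × ∃ λ w → last (v ∷ xs) ≡ just w × Adj G w v

Acyclic : Graph → Set
Acyclic G = ∀ v xs → ¬ IsCycle G v xs

IsTree : Graph → Set
IsTree T = Connected T × Acyclic T

IsRadius : Graph → ℕ → Set
IsRadius T r = (∃ λ c → ∀ t → dist T c t ≤ r) × (∀ c → ∃ λ t → r ≤ dist T c t)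

record TreeDecomp (G : Graph) : Set where
  field
    tree   : Graph
    isTree : IsTree tree
    bag    : Vtx tree → Subset (size G)
    cover  : ∀ v → ∃ λ t → v ∈ₛ bag t
    edges  : ∀ u v → Adj G u v → ∃ λ t → (u ∈ₛ bag t) × (v ∈ₛ bag t)
    interp : ∀ s u xs t → PathBetween tree s u xs → t ∈ₗ (s ∷ xs) →
             ∀ v → v ∈ₛ bag s → v ∈ₛ bag u → v ∈ₛ bag t
open TreeDecomp public

HasWidth : {G : Graph} → TreeDecomp G → ℕ → Set
HasWidth D w = (∀ t → ∣ bag D t ∣ ≤ suc w) × (∃ λ t → ∣ bag D t ∣ ≡ suc w)

IsTreewidth : Graph → ℕ → Set
IsTreewidth G w = (Σ (TreeDecomp G) λ D → HasWidth D w)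
  × (∀ (D : TreeDecomp G) w' → HasWidth D w' → w ≤ w')

-- tree radius, given that tw is the treewidth of G
IsTreeRadius : Graph → (tw : ℕ) → ℕ → Set
IsTreeRadius G tw r = (Σ (TreeDecomp G) λ D → HasWidth D tw × IsRadius (tree D) r)
  × (∀ (D : TreeDecomp G) r' → HasWidth D tw → IsRadius (tree D) r' → r ≤ r')

-- a cop strategy: from the history of distance answers, choose k probe vertices
Strategy : Graph → ℕ → Set
Strategy G k = List (Vec ℕ k) → Vec (Vtx G) k

RobberWalk : Graph → Set
RobberWalk G = Σ (ℕ → Vtx G) λ w → ∀ i → w (suc i) ≡ w i ⊎ Adj G (w i) (w (suc i))

-- answers of rounds 0,…,t−1
history : (G : Graph) {k : ℕ} → Strategy G k → (ℕ → Vtx G) → ℕ → List (Vec ℕ k)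
history G σ w zero    = []
history G σ w (suc t) =
  history G σ w t ++ [ V.map (λ u → dist G u (w t)) (σ (history G σ w t)) ]

-- after round t (0-indexed) the robber's current position is determined uniquely
CapturedAt : (G : Graph) {k : ℕ} → Strategy G k → RobberWalk G → ℕ → Set
CapturedAt G σ (w , _) t = ∀ (w' : RobberWalk G) →
  history G σ (Data.Product.proj₁ w') (suc t) ≡ history G σ w (suc t) →
  Data.Product.proj₁ w' t ≡ w t

CopsWinIn : Graph → ℕ → ℕ → Set
CopsWinIn G k m = Σ (Strategy G k) λ σ → ∀ (R : RobberWalk G) →
  ∃ λ t → t < m × CapturedAt G σ R t

CanLocalize : Graph → ℕ → Set
CanLocalize G k = ∃ λ m → CopsWinIn G k m

IsLocalizationNumber : Graph → ℕ → Set
IsLocalizationNumber G z = CanLocalize G z × (∀ k → CanLocalize G k → z ≤ k)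

IsCaptureTime : Graph → ℕ → ℕ → Set
IsCaptureTime G k c = CopsWinIn G k c × (∀ m → CopsWinIn G k m → c ≤ m)

-- Fix a tree decomposition of width tw whose tree has radius tr about a centre c, rooted at c.
-- The cops keep a current node t and probe every vertex of the bag B_t together with all its
-- neighbours: at most (tw + 1)(Δ + 1) probes. Invariantly, t has depth i in round i and the robber
-- R lies in a bag below t. If R ∈ B_t the zero answer locates him. Otherwise no vertex as close to
-- R as the closest probe u lies in B_t (it would have a probed neighbour closer still), so a
-- shortest u–R path avoids B_t. As B_t separates the subtrees of the children of t, R lies below
-- the child whose subtree holds u, which the cops can compute from the answers; since R ∉ B_t,
-- so does his next position, and the cops descend to that child. The depth is bounded by tr,
-- hence the robber is caught within tr + 1 rounds.

module Submission where

open import Defs hiding (sym)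

open import Data.Bool using (Bool; true; false; T; _∧_)
import Data.Bool as Bool
open import Data.Bool.Properties using (T-≡; T-∧; T-∨)
open import Data.Empty using (⊥; ⊥-elim)
open import Data.Fin using (Fin; toℕ; _≟_)
import Data.Fin as Fin
open import Data.Fin.Properties using (any?; toℕ<n; toℕ-injective; injective⇒≤)
open import Data.Fin.Subset using (Subset; ∣_∣) renaming (_∈_ to _∈ₛ_)
open import Data.Fin.Subset.Properties using (_∈?_)
open import Data.List using (List; []; _∷_; _∷ʳ_; last; allFin)
import Data.List as List
open import Data.List.Membership.Propositional using (lose) renaming (_∈_ to _∈ₗ_)
open import Data.List.Membership.Propositional.Properties using (∈-allFin; ∈-map⁺)
open import Data.List.Properties using (length-map; foldl-∷ʳ; ∷ʳ-injective)
open import Data.List.Relation.Unary.All as All using (All; []; _∷_)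
open import Data.List.Relation.Unary.All.Properties using (∷ʳ⁺)
open import Data.List.Relation.Unary.AllPairs using ([]; _∷_)
open import Data.List.Relation.Unary.Any using (here; there; satisfied)
open import Data.List.Relation.Unary.Any.Properties using (any⁺; any⁻)
open import Data.List.Relation.Unary.Linked using (Linked; []; [-]; _∷_)
import Data.List.Relation.Unary.Linked.Properties as Linked
import Data.List.Relation.Unary.Unique.Propositional.Properties as Unique
open import Data.Maybe using (just)
open import Data.Maybe.Properties using (just-injective)
open import Data.Maybe.Relation.Binary.Connected using (just) renaming (Connected to MaybeConnected)
open import Data.Nat using (ℕ; zero; suc; _+_; _*_; _≤_; _<_; z≤n; s≤s)
import Data.Nat as ℕ
open import Data.Nat.Properties
  using (≤-totalOrder; ≤-refl; ≤-trans; ≤-antisym; ≤-pred; <-irrefl; ≤-<-trans; ≮⇒≥; ≤∧≢⇒<;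
         m≤n⇒m<n∨m≡n; m<1+n⇒m≤n; m≤n⇒m≤1+n; n≤1+n; m≤m+n; +-suc; +-identityʳ; suc-injective)
open import Data.List.Extrema ≤-totalOrder using (argmin; f[argmin]≤f[xs])
open import Data.Product using (Σ; ∃; _×_; _,_; proj₁; proj₂)
open import Data.Sum using (_⊎_; inj₁; inj₂)
open import Data.Vec as Vec using (Vec; []; _∷_)
open import Data.Vec.Membership.Propositional using () renaming (_∈_ to _∈ᵥ_)
open import Data.Vec.Properties using (lookup-map; lookup⇒[]=; lookup∘tabulate)
import Data.Vec.Relation.Unary.Any as AnyV
import Data.Vec.Relation.Unary.Any.Properties as AnyVₚ
open import Function using (_∘_; Injective)
open import Function.Bundles using (Equivalence)
open import Relation.Binary.Definitions using (DecidableEquality)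
open import Relation.Binary.PropositionalEquality
  using (_≡_; _≢_; refl; sym; trans; cong; subst; subst₂; ≢-sym; module ≡-Reasoning)
open import Relation.Nullary using (¬_; Dec; yes; no)
open import Relation.Nullary.Decidable using (map′; _×-dec_; toWitness; fromWitness)

open Equivalence using (to; from)

-- Bounded minimisation

least-≤ : ∀ b f {k} → T (f k) → least b f ≤ k
least-≤ zero    f         fk = z≤n
least-≤ (suc b) f         fk with f zero in eq
... | true = z≤n
least-≤ (suc b) f {zero}  fk | false = ⊥-elim (subst T eq fk)
least-≤ (suc b) f {suc k} fk | false = s≤s (least-≤ b (f ∘ suc) fk)

least-holds : ∀ b f → least b f < b → T (f (least b f))
least-holds (suc b) f lt with f zero in eq
... | true  = subst T (sym eq) _
... | false = least-holds b (f ∘ suc) (≤-pred lt)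

least-minimal : ∀ b f {j} → j < least b f → ¬ T (f j)
least-minimal (suc b) f lt with f zero in eq
least-minimal (suc b) f {zero}  lt | false = subst T eq
least-minimal (suc b) f {suc j} lt | false = least-minimal b (f ∘ suc) (≤-pred lt)

IsLeast : (ℕ → Bool) → ℕ → Set
IsLeast f m = T (f m) × (∀ j → j < m → ¬ T (f j))

IsLeast-unique : ∀ {f m n} → IsLeast f m → IsLeast f n → m ≡ n
IsLeast-unique {m = m} {n} (fm , m-min) (fn , n-min) with m≤n⇒m<n∨m≡n (≮⇒≥ (λ n<m → m-min n n<m fn))
... | inj₂ m≡n = m≡n
... | inj₁ n<m = ⊥-elim (n-min m n<m fm)

least-IsLeast : ∀ b f {k} → T (f k) → k < b → IsLeast f (least b f)
least-IsLeast b f fk k<b =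
  least-holds b f (≤-<-trans (least-≤ b f fk) k<b) , λ j → least-minimal b f

least-≡ : ∀ b f {m} → IsLeast f m → m < b → least b f ≡ m
least-≡ b f isLeast m<b = IsLeast-unique (least-IsLeast b f (proj₁ isLeast) m<b) isLeast

adj-sym : (G : Graph) {u v : Vtx G} → Adj G u v → Adj G v u
adj-sym G {u} {v} uv = trans (Graph.sym G v u) uv

adj⇒≢ : (G : Graph) {u v : Vtx G} → Adj G u v → u ≢ v
adj⇒≢ G {u} uv refl = subst T (irrefl G u) (from T-≡ uv)

last-∷ʳ : ∀ {A : Set} (xs : List A) v → last (xs ∷ʳ v) ≡ just v
last-∷ʳ []           v = refl
last-∷ʳ (x ∷ [])     v = refl
last-∷ʳ (x ∷ y ∷ xs) v = last-∷ʳ (y ∷ xs) v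

path-[] : (G : Graph) {v : Vtx G} → PathBetween G v v []
path-[] G = [-] , [] ∷ [] , refl

path-∷ʳ : (G : Graph) {s u v : Vtx G} {xs : List (Vtx G)} → PathBetween G s u xs →
          Adj G u v → All (_≢ v) (s ∷ xs) → PathBetween G s v (xs ∷ʳ v)
path-∷ʳ G {s} {v = v} {xs} (linked , unique , ends) uv fresh =
  Linked.++⁺ linked (subst (λ m → MaybeConnected (Adj G) m (just v)) (sym ends) (just uv)) [-] ,
  Unique.++⁺ unique ([] ∷ []) (λ { (v∈ , here refl) → All.lookup fresh v∈ refl }) ,
  last-∷ʳ (s ∷ xs) v

path-∷ : (G : Graph) {v s u : Vtx G} {xs : List (Vtx G)} → Adj G v s →
         All (v ≢_) (s ∷ xs) → PathBetween G s u xs → PathBetween G v u (s ∷ xs)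
path-∷ G vs fresh (linked , unique , ends) = vs ∷ linked , fresh ∷ unique , ends

module _ {A : Set} {R : A → A → Set} {P : A → Set} (_≟ᴬ_ : DecidableEquality A) (t : A)
         (exits-via : ∀ {b b′} → P b → R b b′ → b′ ≢ t → P b′) where

  linked-exit-∈ : ∀ {x xs e} → Linked R (x ∷ xs) → P x → last (x ∷ xs) ≡ just e → ¬ P e → t ∈ₗ x ∷ xs
  linked-exit-∈ {xs = []}     _          px refl ¬pe = ⊥-elim (¬pe px)
  linked-exit-∈ {xs = y ∷ xs} (xy ∷ rest) px ends ¬pe with y ≟ᴬ t
  ... | yes refl = there (here refl)
  ... | no y≢t   = there (linked-exit-∈ rest (exits-via px xy y≢t) ends ¬pe)

members : ∀ {n} → Subset n → List (Fin n)
members []           = []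
members (true ∷ p)  = Fin.zero ∷ List.map Fin.suc (members p)
members (false ∷ p) = List.map Fin.suc (members p)

length-members : ∀ {n} (p : Subset n) → List.length (members p) ≡ ∣ p ∣
length-members []          = refl
length-members (true ∷ p)  = cong suc (trans (length-map Fin.suc (members p)) (length-members p))
length-members (false ∷ p) = trans (length-map Fin.suc (members p)) (length-members p)

∈-members : ∀ {n} {p : Subset n} {i} → i ∈ₛ p → i ∈ₗ members p
∈-members Vec.here = here refl
∈-members {p = true ∷ p}  (Vec.there i∈p) = there (∈-map⁺ Fin.suc (∈-members i∈p))
∈-members {p = false ∷ p} (Vec.there i∈p) = ∈-map⁺ Fin.suc (∈-members i∈p)

∈-padRight⁺ : ∀ {A : Set} {m n} (m≤n : m ≤ n) (a : A) {xs : Vec A m} {x} → x ∈ᵥ xs → x ∈ᵥ Vec.padRight m≤n a xs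
∈-padRight⁺ (s≤s m≤n) a (AnyV.here x≡)    = AnyV.here x≡
∈-padRight⁺ (s≤s m≤n) a (AnyV.there x∈xs) = AnyV.there (∈-padRight⁺ m≤n a x∈xs)

argminᵥ : ∀ {n} → Vec ℕ (suc n) → Fin (suc n)
argminᵥ {n} v = argmin (Vec.lookup v) Fin.zero (allFin (suc n))

argminᵥ-≤ : ∀ {n} (v : Vec ℕ (suc n)) j → Vec.lookup v (argminᵥ v) ≤ Vec.lookup v j
argminᵥ-≤ {n} v j = All.lookup (f[argmin]≤f[xs] {f = Vec.lookup v} Fin.zero (allFin (suc n))) (∈-allFin j)

witness-or : ∀ {A : Set} {P : A → Set} → Dec (∃ P) → A → A
witness-or (yes (a , _)) _ = a
witness-or (no _)        d = d

witness-or-satisfies : ∀ {A : Set} {P : A → Set} (dec : Dec (∃ P)) d → ∃ P → P (witness-or dec d)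
witness-or-satisfies (yes (_ , pa)) _ _  = pa
witness-or-satisfies (no ¬∃)        _ ex = ⊥-elim (¬∃ ex)

-- Graph distance

module Distance (G : Graph) where

  -- A record rather than an alias of T (reachWithin G k u v), so that k, u and v can be inferred.
  record Reach (k : ℕ) (u v : Vtx G) : Set where
    constructor reach
    field reaches : T (reachWithin G k u v)
  open Reach

  reach-≡ : ∀ {u v} → Reach 0 u v → u ≡ v
  reach-≡ = toWitness ∘ reaches

  reach-refl : ∀ u → Reach 0 u u
  reach-refl u = reach (fromWitness refl)

  reach-suc : ∀ {k u v} → Reach k u v → Reach (suc k) u v
  reach-suc r = reach (from T-∨ (inj₁ (reaches r)))

  reach-step : ∀ {k u w v} → Reach k u w → Adj G w v → Reach (suc k) u v
  reach-step {w = w} r wv = reach (from T-∨ (inj₂ (any⁺ _ (lose (∈-allFin w) (from T-∧ (reaches r , from T-≡ wv))))))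

  reach-pred : ∀ {k u v} → Reach (suc k) u v → Reach k u v ⊎ ∃ λ w → Reach k u w × Adj G w v
  reach-pred {k} {u} {v} r with to T-∨ (reaches r)
  ... | inj₁ r′ = inj₁ (reach r′)
  ... | inj₂ r′ with satisfied (any⁻ (λ w → reachWithin G k u w ∧ adj G w v) (allFin (size G)) r′)
  ... | w , rw = let (r″ , wv) = to T-∧ rw in inj₂ (w , reach r″ , to T-≡ wv)

  reach-cons : ∀ {k u w v} → Adj G u w → Reach k w v → Reach (suc k) u v
  reach-cons {zero}  {u} uw r with refl ← reach-≡ r = reach-step (reach-refl u) uw
  reach-cons {suc k}     uw r with reach-pred r
  ... | inj₁ r′            = reach-suc (reach-cons uw r′)
  ... | inj₂ (x , r′ , xv) = reach-step (reach-cons uw r′) xv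

  reach-sym : ∀ {k u v} → Reach k u v → Reach k v u
  reach-sym {zero}  {u} r with refl ← reach-≡ r = r
  reach-sym {suc k}     r with reach-pred r
  ... | inj₁ r′            = reach-suc (reach-sym r′)
  ... | inj₂ (w , r′ , wv) = reach-cons (adj-sym G wv) (reach-sym r′)

  walk⇒reach : ∀ {u v} → Walk G u v → ∃ λ k → Reach k u v
  walk⇒reach {u} here       = 0 , reach-refl u
  walk⇒reach     (step uw p) = let (k , r) = walk⇒reach p in suc k , reach-cons uw r

  Shortest : Vtx G → Vtx G → ℕ → Set
  Shortest u v d = Reach d u v × (∀ j → j < d → ¬ Reach j u v)

  shortest-exists : ∀ {k u v} → Reach k u v → ∃ λ d → Shortest u v d
  shortest-exists {k} r =
    let (holds , minimal) = least-IsLeast (suc k) _ (reaches r) ≤-refl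
    in _ , reach holds , λ j j<d → minimal j j<d ∘ reaches

  shortest⇒IsLeast : ∀ {u v d} → Shortest u v d → IsLeast (λ k → reachWithin G k u v) d
  shortest⇒IsLeast (r , minimal) = reaches r , λ j j<d → minimal j j<d ∘ reach

  shortest-unique : ∀ {u v d e} → Shortest u v d → Shortest u v e → d ≡ e
  shortest-unique s s′ = IsLeast-unique (shortest⇒IsLeast s) (shortest⇒IsLeast s′)

  shortest-sym : ∀ {u v d} → Shortest u v d → Shortest v u d
  shortest-sym (r , minimal) = reach-sym r , λ j j<d → minimal j j<d ∘ reach-sym

  shortest-pred : ∀ {u x d} → Shortest u x (suc d) → ∃ λ w → Shortest u w d × Adj G w x
  shortest-pred {d = d} (r , minimal) with reach-pred r
  ... | inj₁ r′ = ⊥-elim (minimal d ≤-refl r′)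
  ... | inj₂ (w , r′ , wx) = w , (r′ , λ j j<d rj → minimal (suc j) (s≤s j<d) (reach-step rj wx)) , wx

  shortest-layer : ∀ {u x} d → Shortest u x d → ∀ e → e ≤ d → ∃ λ y → Shortest u y e
  shortest-layer d s e e≤d with m≤n⇒m<n∨m≡n e≤d
  ... | inj₂ refl = _ , s
  shortest-layer zero    s e _ | inj₁ ()
  shortest-layer (suc d) s e _ | inj₁ e<1+d =
    shortest-layer d (proj₁ (proj₂ (shortest-pred s))) e (m<1+n⇒m≤n e<1+d)

  -- The layers at distance 0, …, d from u are pairwise distinct.
  shortest-< : ∀ {u v d} → Shortest u v d → d < size G
  shortest-< {u} {v} {d} s = injective⇒≤ layer-injective
    where
    layer : (i : Fin (suc d)) → Σ (Vtx G) λ y → Shortest u y (toℕ i)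
    layer i = shortest-layer d s (toℕ i) (m<1+n⇒m≤n (toℕ<n i))
    layer-injective : Injective _≡_ _≡_ (proj₁ ∘ layer)
    layer-injective {i} {j} eq = toℕ-injective
      (shortest-unique (proj₂ (layer i)) (subst (λ y → Shortest u y (toℕ j)) (sym eq) (proj₂ (layer j))))

  shortest⇒dist : ∀ {u v d} → Shortest u v d → dist G u v ≡ d
  shortest⇒dist s = least-≡ (size G) _ (shortest⇒IsLeast s) (shortest-< s)

  module _ (connected : Connected G) where

    dist-shortest : ∀ u v → Shortest u v (dist G u v)
    dist-shortest u v =
      let (d , s) = shortest-exists (proj₂ (walk⇒reach (proj₂ connected u v)))
      in subst (Shortest u v) (sym (shortest⇒dist s)) s

    dist-refl : ∀ u → dist G u u ≡ 0
    dist-refl u = shortest⇒dist (reach-refl u , λ _ ())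

    dist≡0⇒≡ : ∀ {u v} → dist G u v ≡ 0 → u ≡ v
    dist≡0⇒≡ {u} {v} d≡0 = reach-≡ (subst (λ k → Reach k u v) d≡0 (proj₁ (dist-shortest u v)))

    dist-sym : ∀ u v → dist G u v ≡ dist G v u
    dist-sym u v = shortest⇒dist (shortest-sym (dist-shortest v u))

    dist-adj : ∀ u {x y} → Adj G x y → dist G u y ≤ suc (dist G u x)
    dist-adj u {x} {y} xy = ≮⇒≥ λ lt →
      proj₂ (dist-shortest u y) _ lt (reach-step (proj₁ (dist-shortest u x)) xy)

    dist-pred : ∀ u {x d} → dist G u x ≡ suc d → ∃ λ p → Adj G p x × dist G u p ≡ d
    dist-pred u {x} eq =
      let (p , s , px) = shortest-pred (subst (Shortest u x) eq (dist-shortest u x))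
      in p , px , shortest⇒dist s

    path-between : ∀ u v → ∃ λ xs → PathBetween G u v xs
    path-between u v = let (xs , path , _) = short-path (dist G u v) v refl in xs , path
      where
      short-path : ∀ d v → dist G u v ≡ d →
        ∃ λ xs → PathBetween G u v xs × All (λ y → dist G u y ≤ d) (u ∷ xs)
      short-path zero v d≡0 with refl ← dist≡0⇒≡ d≡0 =
        [] , ([-] , [] ∷ [] , refl) , subst (_≤ 0) (sym d≡0) ≤-refl ∷ []
      short-path (suc d) v d≡ =
        let (p , pv , p≡) = dist-pred u d≡
            (xs , path , near) = short-path d p p≡
            fresh : ∀ {y} → dist G u y ≤ d → y ≢ v
            fresh y≤d y≡v = <-irrefl refl (subst (_≤ d) (trans (cong (dist G u) y≡v) d≡) y≤d)
        in xs ∷ʳ v , path-∷ʳ G path pv (All.map fresh near) ,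
           ∷ʳ⁺ (All.map m≤n⇒m≤1+n near) (subst (_≤ suc d) (sym d≡) ≤-refl)

    dist-toward : ∀ {x v d} → dist G x v ≡ suc d → ∃ λ p → Adj G x p × dist G p v ≡ d
    dist-toward {x} {v} eq =
      let (p , px , dp) = dist-pred v (trans (dist-sym v x) eq)
      in p , adj-sym G px , trans (dist-sym p v) dp

    module _ (P Barrier : Vtx G → Set) (spread : ∀ {x y} → P x → ¬ Barrier x → Adj G x y → P y)
             (centre : Vtx G) (r : ℕ) (clear : ∀ x → dist G x centre ≤ r → ¬ Barrier x) where

      ball-transport-to : ∀ x → dist G x centre ≤ r → P x → P centre
      ball-transport-to x = go (dist G x centre) x refl
        where
        go : ∀ d x → dist G x centre ≡ d → d ≤ r → P x → P centre
        go zero    x d≡0 _   px with refl ← dist≡0⇒≡ d≡0 = px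
        go (suc d) x d≡  d≤r px =
          let (p , xp , dp) = dist-toward d≡
              x-clear = clear x (subst (_≤ r) (sym d≡) d≤r)
          in go d p dp (≤-trans (n≤1+n d) d≤r) (spread px x-clear xp)

      ball-transport-from : ∀ x → dist G x centre ≤ r → P centre → P x
      ball-transport-from x = go (dist G x centre) x refl
        where
        go : ∀ d x → dist G x centre ≡ d → d ≤ r → P centre → P x
        go zero    x d≡0 _   pc with refl ← dist≡0⇒≡ d≡0 = pc
        go (suc d) x d≡  d≤r pc =
          let (p , xp , dp) = dist-toward d≡
              p≤r = ≤-trans (n≤1+n d) d≤r
          in spread (go d p dp p≤r pc) (clear p (subst (_≤ r) (sym dp) p≤r)) (adj-sym G xp)

    locate : ∀ {n} {ps : Vec (Vtx G) n} {x y} → x ∈ᵥ ps →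
             Vec.map (λ u → dist G u y) ps ≡ Vec.map (λ u → dist G u x) ps → y ≡ x
    locate {n} {ps} {x} {y} x∈ps same = sym (dist≡0⇒≡ (begin
      dist G x y                              ≡⟨ cong (λ u → dist G u y) x≡pᵢ ⟩
      dist G (Vec.lookup ps i) y              ≡⟨ lookup-map i _ ps ⟨
      Vec.lookup (Vec.map (λ u → dist G u y) ps) i ≡⟨ cong (λ v → Vec.lookup v i) same ⟩
      Vec.lookup (Vec.map (λ u → dist G u x) ps) i ≡⟨ lookup-map i _ ps ⟩
      dist G (Vec.lookup ps i) x              ≡⟨ cong (λ u → dist G u x) x≡pᵢ ⟨
      dist G x x                              ≡⟨ dist-refl x ⟩
      0                                       ∎))
      where
      open ≡-Reasoning
      i : Fin n
      i = AnyV.index x∈ps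
      x≡pᵢ : x ≡ Vec.lookup ps i
      x≡pᵢ = AnyVₚ.lookup-index x∈ps

-- Rooted trees and tree decompositions

module RootedTree (T : Graph) (isTree : IsTree T) (root : Vtx T) where
  open Distance T
  private
    connected : Connected T
    connected = proj₁ isTree
    acyclic : Acyclic T
    acyclic = proj₂ isTree

  -- Opaque because unfolding dist during unification is prohibitively expensive.
  opaque
    depth : Vtx T → ℕ
    depth = dist T root

  opaque
    unfolding depth

    depth≡dist : ∀ x → depth x ≡ dist T root x
    depth≡dist x = refl

    depth-root : depth root ≡ 0
    depth-root = dist-refl connected root

    depth≡0⇒root : ∀ {x} → depth x ≡ 0 → x ≡ root
    depth≡0⇒root = sym ∘ dist≡0⇒≡ connected

    depth-parent : ∀ {x d} → depth x ≡ suc d → ∃ λ p → Adj T p x × depth p ≡ d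
    depth-parent = dist-pred connected root

    depth-adj : ∀ {x y} → Adj T x y → depth y ≤ suc (depth x)
    depth-adj = dist-adj connected root

  private
    deeper⇒≢ : ∀ {e v y} → depth v ≡ e → suc e ≤ depth y → v ≢ y
    deeper⇒≢ dv lt refl = <-irrefl (sym dv) lt

  -- Joining the parents of the two ends yields either a cycle or such a path one level higher.
  no-deep-path : ∀ e {x x′ Π} → depth x ≡ e → depth x′ ≡ e → x ≢ x′ →
                 PathBetween T x′ x Π → All (λ y → e ≤ depth y) (x′ ∷ Π) → ⊥
  no-deep-path zero dx dx′ x≢x′ _ _ = x≢x′ (trans (depth≡0⇒root dx) (sym (depth≡0⇒root dx′)))
  no-deep-path (suc e) {x} {x′} {Π} dx dx′ x≢x′ path deep
    with depth-parent dx | depth-parent dx′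
  ... | p , px , dp | p′ , p′x′ , dp′ with p ≟ p′
  ... | yes refl =
    let (linked , unique , ends) = path-∷ T p′x′ (All.map (deeper⇒≢ dp′) deep) path
    in acyclic p (x′ ∷ Π) (two-edges Π ends , linked , unique , x , ends , adj-sym T px)
    where
    two-edges : ∀ Π → last (p ∷ x′ ∷ Π) ≡ just x → 2 ≤ List.length (x′ ∷ Π)
    two-edges []      ends = ⊥-elim (x≢x′ (sym (just-injective ends)))
    two-edges (_ ∷ _) _    = s≤s (s≤s z≤n)
  ... | no p≢p′ = no-deep-path e dp dp′ p≢p′
    (path-∷ T p′x′ (∷ʳ⁺ (All.map (deeper⇒≢ dp′) deep) (≢-sym p≢p′))
      (path-∷ʳ T path (adj-sym T px) (All.map (≢-sym ∘ deeper⇒≢ dp) deep)))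
    (subst (e ≤_) (sym dp′) ≤-refl ∷ ∷ʳ⁺ (All.map (≤-trans (n≤1+n e)) deep) (subst (e ≤_) (sym dp) ≤-refl))

  no-level-edge : ∀ {b b′} → Adj T b b′ → depth b ≢ depth b′
  no-level-edge {b} {b′} bb′ eq = no-deep-path (depth b) refl (sym eq) (adj⇒≢ T bb′)
    (path-∷ T (adj-sym T bb′) (≢-sym (adj⇒≢ T bb′) ∷ []) (path-[] T))
    (subst (depth b ≤_) eq ≤-refl ∷ ≤-refl ∷ [])

  shallower-neighbour-unique : ∀ {b p p′} → Adj T b p → Adj T b p′ →
                           depth p ≤ depth b → depth p′ ≤ depth b → p ≡ p′
  shallower-neighbour-unique {b} {p} {p′} bp bp′ p≤b p′≤b with p ≟ p′
  ... | yes p≡p′ = p≡p′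
  ... | no p≢p′ = ⊥-elim (no-deep-path (depth p) refl (sym same-depth) p≢p′
          (path-∷ T (adj-sym T bp′) (≢-sym (adj⇒≢ T bp′) ∷ ≢-sym p≢p′ ∷ [])
            (path-∷ T bp (adj⇒≢ T bp ∷ []) (path-[] T)))
          (subst (depth p ≤_) same-depth ≤-refl ∷ ≤-trans (n≤1+n _) (one-below bp p≤b) ∷ ≤-refl ∷ []))
    where
    one-below : ∀ {q} → Adj T b q → depth q ≤ depth b → suc (depth q) ≤ depth b
    one-below bq q≤b = ≤∧≢⇒< q≤b (no-level-edge (adj-sym T bq))
    parent-depth : ∀ {q} → Adj T b q → depth q ≤ depth b → depth b ≡ suc (depth q)
    parent-depth bq q≤b = ≤-antisym (depth-adj (adj-sym T bq)) (one-below bq q≤b)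
    same-depth : depth p ≡ depth p′
    same-depth = suc-injective (trans (sym (parent-depth bp p≤b)) (parent-depth bp′ p′≤b))

  Child : Vtx T → Vtx T → Set
  Child t s = Adj T t s × depth s ≡ suc (depth t)

  child? : ∀ t s → Dec (Child t s)
  child? t s = (adj T t s Bool.≟ true) ×-dec (depth s ℕ.≟ suc (depth t))

  data Descendant (s : Vtx T) : Vtx T → Set where
    self  : Descendant s s
    below : ∀ {p a} → Descendant s p → Child p a → Descendant s a

  descendant-split : ∀ {t a} → Descendant t a → a ≡ t ⊎ ∃ λ s → Child t s × Descendant s a
  descendant-split self = inj₁ refl
  descendant-split (below d pa) with descendant-split d
  ... | inj₁ refl             = inj₂ (_ , pa , self)
  ... | inj₂ (s , ts , sd)    = inj₂ (s , ts , below sd pa)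

  root-descendant : ∀ a → Descendant root a
  root-descendant a = at-depth (depth a) refl
    where
    at-depth : ∀ {a} d → depth a ≡ d → Descendant root a
    at-depth zero    da with refl ← depth≡0⇒root da = self
    at-depth (suc d) da =
      let (p , pa , dp) = depth-parent da
      in below (at-depth d dp) (pa , trans da (cong suc (sym dp)))

  descendant? : ∀ s a → Dec (Descendant s a)
  descendant? s a = bounded (suc (depth a)) a ≤-refl
    where
    bounded : ∀ n a → depth a < n → Dec (Descendant s a)
    parent? : ∀ n a → depth a < suc n → ∀ p → Dec (Child p a × Descendant s p)

    bounded (suc n) a lt with a ≟ s
    ... | yes refl = yes self
    ... | no a≢s = map′ (λ (_ , pa , d) → below d pa)
                        (λ { self → ⊥-elim (a≢s refl) ; (below d pa) → _ , pa , d })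
                        (any? (parent? n a lt))

    parent? n a lt p with child? p a
    ... | no ¬pa = no (¬pa ∘ proj₁)
    ... | yes pa = map′ (pa ,_) proj₂ (bounded n p (≤-pred (subst (_< suc n) (proj₂ pa) lt)))

  descendant-adj : ∀ {t s b b′} → Child t s → Descendant s b → Adj T b b′ → b′ ≢ t → Descendant s b′
  descendant-adj {t} {s} {b} {b′} ts d bb′ b′≢t with depth b′ ℕ.≟ suc (depth b)
  ... | yes deeper = below d (bb′ , deeper)
  ... | no ¬deeper = upward d
    where
    b′≤b : depth b′ ≤ depth b
    b′≤b = m<1+n⇒m≤n (≤∧≢⇒< (depth-adj bb′) ¬deeper)
    upward : Descendant s b → Descendant s b′
    upward self = ⊥-elim (b′≢t (shallower-neighbour-unique bb′ (adj-sym T (proj₁ ts)) b′≤b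
                                  (subst (depth t ≤_) (sym (proj₂ ts)) (n≤1+n _))))
    upward (below {p} d′ (pb , db)) with refl ← shallower-neighbour-unique (adj-sym T pb) bb′
                                                  (subst (depth p ≤_) (sym db) (n≤1+n _)) b′≤b = d′

module Decomposition (G : Graph) (D : TreeDecomp G) (root : Vtx (tree D)) where
  open RootedTree (tree D) (isTree D) root public
  open Distance (tree D) using (path-between)

  InSubtree : Vtx (tree D) → Vtx G → Set
  InSubtree s x = ∃ λ a → Descendant s a × x ∈ₛ bag D a

  inSubtree? : ∀ s x → Dec (InSubtree s x)
  inSubtree? s x = any? λ a → descendant? s a ×-dec (x ∈? bag D a)

  child-holding : ∀ {t x} → InSubtree t x → ¬ x ∈ₛ bag D t → ∃ λ s → Child t s × InSubtree s x
  child-holding (a , ta , x∈a) x∉t with descendant-split ta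
  ... | inj₁ refl           = ⊥-elim (x∉t x∈a)
  ... | inj₂ (s , ts , sa) = s , ts , a , sa , x∈a

  -- Some bag contains both x and y; were it outside the subtree of s, the tree path to it
  -- from a bag of x below s would pass through t, and x would lie in B_t.
  inSubtree-adj : ∀ {t s x y} → Child t s → InSubtree s x → ¬ x ∈ₛ bag D t → Adj G x y → InSubtree s y
  inSubtree-adj {t} {s} {x} {y} ts (a , sa , x∈a) x∉t xy with edges D x y xy
  ... | e , x∈e , y∈e with descendant? s e
  ... | yes se = e , se , y∈e
  ... | no ¬se with path-between (proj₁ (isTree D)) a e
  ... | xs , path@(linked , _ , ends) =
    ⊥-elim (x∉t (interp D a e xs t path (linked-exit-∈ _≟_ t (descendant-adj ts) linked sa ends ¬se) x x∈a x∈e))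

-- The cop strategy

module Localization (G : Graph) (connected : Connected G) (tw Δ : ℕ) (D : TreeDecomp G)
                    (width : ∀ t → ∣ bag D t ∣ ≤ suc tw) (max-degree : ∀ v → degree G v ≤ Δ)
                    (root : Vtx (tree D)) where
  open Decomposition G D root
  open Distance G using (dist≡0⇒≡; dist-toward; ball-transport-to; ball-transport-from; locate)

  K : ℕ
  K = suc tw * suc Δ

  neighbour-count : ∀ v → List.length (members (Vec.tabulate (adj G v))) ≤ Δ
  neighbour-count v = subst (_≤ Δ) (sym (length-members (Vec.tabulate (adj G v)))) (max-degree v)

  -- Padding only repeats existing vertices, i.e. duplicates probes.
  neighbours : Vtx G → Vec (Vtx G) Δ
  neighbours v = Vec.padRight (neighbour-count v) v (Vec.fromList (members (Vec.tabulate (adj G v))))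

  ∈-neighbours : ∀ {x y} → Adj G x y → y ∈ᵥ neighbours x
  ∈-neighbours {x} {y} xy = ∈-padRight⁺ (neighbour-count x) x (AnyVₚ.fromList⁺ (∈-members y∈row))
    where
    y∈row : y ∈ₛ Vec.tabulate (adj G x)
    y∈row = lookup⇒[]= y _ (trans (lookup∘tabulate (adj G x) y) xy)

  bag-count : ∀ t → List.length (members (bag D t)) ≤ suc tw
  bag-count t = subst (_≤ suc tw) (sym (length-members (bag D t))) (width t)

  bag-vec : Vtx (tree D) → Vec (Vtx G) (suc tw)
  bag-vec t = Vec.padRight (bag-count t) (proj₁ connected) (Vec.fromList (members (bag D t)))

  ∈-bag-vec : ∀ {t x} → x ∈ₛ bag D t → x ∈ᵥ bag-vec t
  ∈-bag-vec {t} x∈t = ∈-padRight⁺ (bag-count t) (proj₁ connected) (AnyVₚ.fromList⁺ (∈-members x∈t))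

  probes : Vtx (tree D) → Vec (Vtx G) K
  probes t = Vec.concat (Vec.map (λ v → v ∷ neighbours v) (bag-vec t))

  closed-nbhd⊆probes : ∀ {t x y} → x ∈ₛ bag D t → y ∈ᵥ x ∷ neighbours x → y ∈ᵥ probes t
  closed-nbhd⊆probes x∈t y∈ = AnyVₚ.concat⁺ (AnyVₚ.map⁺ (AnyV.map (λ { refl → y∈ }) (∈-bag-vec x∈t)))

  bag⊆probes : ∀ {t x} → x ∈ₛ bag D t → x ∈ᵥ probes t
  bag⊆probes x∈t = closed-nbhd⊆probes x∈t (AnyV.here refl)

  neighbour∈probes : ∀ {t x y} → x ∈ₛ bag D t → Adj G x y → y ∈ᵥ probes t
  neighbour∈probes x∈t xy = closed-nbhd⊆probes x∈t (AnyV.there (∈-neighbours xy))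

  answers : Vtx (tree D) → Vtx G → Vec ℕ K
  answers t R = Vec.map (λ u → dist G u R) (probes t)

  closest-probe : Vtx (tree D) → Vec ℕ K → Vtx G
  closest-probe t ans = Vec.lookup (probes t) (argminᵥ ans)

  closest-probe-≤ : ∀ t R {y} → y ∈ᵥ probes t → dist G (closest-probe t (answers t R)) R ≤ dist G y R
  closest-probe-≤ t R {y} y∈ = subst₂ _≤_
    (lookup-map (argminᵥ (answers t R)) (λ u → dist G u R) (probes t))
    (trans (lookup-map (AnyV.index y∈) (λ u → dist G u R) (probes t)) (cong (λ v → dist G v R) (sym (AnyVₚ.lookup-index y∈))))
    (argminᵥ-≤ (answers t R) (AnyV.index y∈))

  toward? : ∀ t ans → Dec (∃ λ s → Child t s × InSubtree s (closest-probe t ans))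
  toward? t ans = any? λ s → child? t s ×-dec inSubtree? s (closest-probe t ans)

  next : Vtx (tree D) → Vec ℕ K → Vtx (tree D)
  next t ans = witness-or (toward? t ans) t

  node : List (Vec ℕ K) → Vtx (tree D)
  node = List.foldl next root

  strategy : Strategy G K
  strategy = probes ∘ node

  module Round (t : Vtx (tree D)) (R : Vtx G) (hidden : InSubtree t R) (R∉t : ¬ R ∈ₛ bag D t) where

    r : ℕ
    r = dist G (closest-probe t (answers t R)) R

    -- A vertex of B_t at distance d ≥ 1 from R has a probed neighbour at distance d − 1,
    -- closer to R than the closest probe.
    near-avoids-bag : ∀ x → dist G x R ≤ r → ¬ x ∈ₛ bag D t
    near-avoids-bag x = at-distance (dist G x R) refl
      where
      at-distance : ∀ d → dist G x R ≡ d → d ≤ r → ¬ x ∈ₛ bag D t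
      at-distance zero    d≡0 _   x∈t = R∉t (subst (_∈ₛ bag D t) (dist≡0⇒≡ connected d≡0) x∈t)
      at-distance (suc k) d≡  d≤r x∈t =
        let (p , xp , dp) = dist-toward connected d≡
        in <-irrefl refl (≤-trans d≤r (subst (r ≤_) dp (closest-probe-≤ t R (neighbour∈probes x∈t xp))))

    transport-to : ∀ {s} → Child t s → ∀ x → dist G x R ≤ r → InSubtree s x → InSubtree s R
    transport-to ts = ball-transport-to connected _ _ (inSubtree-adj ts) R r near-avoids-bag

    transport-from : ∀ {s} → Child t s → ∀ x → dist G x R ≤ r → InSubtree s R → InSubtree s x
    transport-from ts = ball-transport-from connected _ _ (inSubtree-adj ts) R r near-avoids-bag

    advance : ∀ {R′} → R′ ≡ R ⊎ Adj G R R′ →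
           Child t (next t (answers t R)) × InSubtree (next t (answers t R)) R′
    advance {R′} moved =
      let (s₀ , ts₀ , s₀R) = child-holding hidden R∉t
          u         = closest-probe t (answers t R)
          (ts , su) = witness-or-satisfies (toward? t (answers t R)) t
                        (s₀ , ts₀ , transport-from ts₀ u ≤-refl s₀R)
      in ts , follow ts (transport-to ts u ≤-refl su) moved
      where
      follow : ∀ {s} → Child t s → InSubtree s R → R′ ≡ R ⊎ Adj G R R′ → InSubtree s R′
      follow _  sR (inj₁ refl) = sR
      follow ts sR (inj₂ RR′)  = inSubtree-adj ts sR R∉t RR′

  module Play (robber : RobberWalk G) where

    position : ℕ → Vtx G
    position = proj₁ robber

    current : ℕ → Vtx (tree D)
    current i = node (history G strategy position i)

    current-suc : ∀ i → current (suc i) ≡ next (current i) (answers (current i) (position i))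
    current-suc i = foldl-∷ʳ next root (answers (current i) (position i)) (history G strategy position i)

    Chasing : ℕ → Set
    Chasing i = depth (current i) ≡ i × InSubtree (current i) (position i)

    chasing-zero : Chasing 0
    chasing-zero =
      let (a , x∈a) = cover D (position 0) in depth-root , a , root-descendant a , x∈a

    chasing-suc : ∀ {i} → Chasing i → ¬ position i ∈ₛ bag D (current i) → Chasing (suc i)
    chasing-suc {i} (depth≡i , hidden) escaped =
      let (ts , moved) = Round.advance (current i) (position i) hidden escaped (proj₂ robber i)
      in subst (λ t → depth t ≡ suc i × InSubtree t (position (suc i))) (sym (current-suc i))
               (trans (proj₂ ts) (cong suc depth≡i) , moved)

    caught : ∀ i → position i ∈ₛ bag D (current i) → CapturedAt G strategy robber i
    caught i x∈t (position′ , _) same-history = locate connected (bag⊆probes x∈t) same-answers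
      where
      same-last : history G strategy position′ i ≡ history G strategy position i ×
                  Vec.map (λ u → dist G u (position′ i)) (strategy (history G strategy position′ i))
                    ≡ answers (current i) (position i)
      same-last = ∷ʳ-injective (history G strategy position′ i) (history G strategy position i) same-history
      same-answers : answers (current i) (position′ i) ≡ answers (current i) (position i)
      same-answers = subst (λ h → Vec.map (λ u → dist G u (position′ i)) (strategy h) ≡ answers (current i) (position i))
                           (proj₁ same-last) (proj₂ same-last)

    module _ (tr : ℕ) (radius : ∀ x → depth x ≤ tr) where

      capture-within : ∀ k i → i + k ≡ tr → Chasing i → ∃ λ j → j < suc tr × CapturedAt G strategy robber j
      capture-within k i i+k≡tr chasing = decide k i+k≡tr (position i ∈? bag D (current i))
        where
        decide : ∀ k → i + k ≡ tr → Dec (position i ∈ₛ bag D (current i)) →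
                 ∃ λ j → j < suc tr × CapturedAt G strategy robber j
        decide k       i+k≡tr (yes x∈t)    = i , s≤s (subst (i ≤_) i+k≡tr (m≤m+n i k)) , caught i x∈t
        decide zero    i+0≡tr (no escaped) =
          ⊥-elim (<-irrefl (trans (sym (+-identityʳ i)) i+0≡tr)
                   (subst (_≤ tr) (proj₁ (chasing-suc chasing escaped)) (radius (current (suc i)))))
        decide (suc k) i+k≡tr (no escaped) =
          capture-within k (suc i) (trans (sym (+-suc i k)) i+k≡tr) (chasing-suc chasing escaped)

  cops-win : ∀ tr → (∀ x → dist (tree D) root x ≤ tr) → CopsWinIn G K (suc tr)
  cops-win tr radius = strategy , λ robber →
    Play.capture-within robber tr (λ x → subst (_≤ tr) (sym (depth≡dist x)) (radius x)) tr 0 refl (Play.chasing-zero robber)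

mainTheorem17 : (G : Graph) → Connected G → (tw Δ tr : ℕ) →
    IsTreewidth G tw → IsMaxDegree G Δ → IsTreeRadius G tw tr →
    (∀ z → IsLocalizationNumber G z → z ≤ suc tw * suc Δ)
    × (∀ c → IsCaptureTime G (suc tw * suc Δ) c → c ≤ suc tr)
mainTheorem17 G connected tw Δ tr _ (max-degree , _) ((D , (width , _) , (root , radius) , _) , _) =
  (λ z (_ , minimal) → minimal (suc tw * suc Δ) (suc tr , win)) , (λ c (_ , fastest) → fastest (suc tr) win)
  where
  win : CopsWinIn G (suc tw * suc Δ) (suc tr)
  win = Localization.cops-win G connected tw Δ D width max-degree root tr radius
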